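{- Let $X,Y,D \in [1,\infty)$ with $D\leq \min(X,Y)$ and $\delta\in(0,1]$. Let $A\subset[X,2X]$ and $B\subset[Y,2Y]$ be sets of integers, and let $\Omega\subset A\times B$ satisfy $|\Omega| \geq \frac{\delta}{2}|A||B|$ and $\gcd(a,b)\geq D$ for all $(a,b)\in\Omega$. Suppose there is a positive integer $N$ such that $|v_p(a/N)|+|v_p(b/N)|\leq 1$ for all primes $p$ and all $(a,b)\in\Omega$. Then \[ |A||B| \leq 1000\,\delta^{ -2}\,\frac{XY}{D^2}. \]
   Context: For a prime $p$ and an integer $a$, $v_p(a)$ is the largest $k$ with $p^k\mid a$, extended to rationals by $v_p(a/b)=v_p(a)-v_p(b)$.
   Formalization: The parameters X, Y, D and δ are rational, ranging over the rational points of $[1,\infty)$ and $(0,1]$ respectively. -}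

module Defs where

open import Data.Nat using (ℕ; suc; _^_; ∣_-_∣) renaming (_≤_ to _≤ℕ_)
open import Data.Nat.Divisibility using (_∣_)
open import Data.Nat.Primality using (Prime)
open import Data.Integer using (+_)
open import Data.Rational using (ℚ; _/_)
open import Data.Product using (_×_)
open import Relation.Nullary using (¬_)

⟦_⟧ : ℕ → ℚ
⟦ n ⟧ = + n / 1

IsVal : ℕ → ℕ → ℕ → Set
IsVal p a k = (p ^ k ∣ a) × ¬ (p ^ suc k ∣ a)

-- |v_p(a/N)| + |v_p(b/N)| ≤ 1, where v_p(a/N) = v_p(a) − v_p(N)
ValCond : ℕ → ℕ → ℕ → ℕ → Set
ValCond p N a b = ∀ ka kb kN → IsVal p a ka → IsVal p b kb → IsVal p N kN →
  ∣ ka - kN ∣ Data.Nat.+ ∣ kb - kN ∣ ≤ℕ 1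

{-# OPTIONS --safe #-}
-- Write c(n) = N / gcd(n, N). The valuation hypothesis implies that gcd(a,b)·N divides
-- gcd(a,N)·gcd(b,N), i.e. gcd(a,b)·c(a)·c(b) ≤ N, so D·c(a)·c(b) ≤ N on Ω.
-- Since N ∣ b·c(b), at most 2Y·d/N elements b of B have c(b) = d; summing over the
-- values d gives D·c(a)·Σ_b 1/c(b) ≤ 2Y over the b paired with a fixed a, hence
-- D·Σ_Ω c(a)/c(b) ≤ 2Y|A|, and symmetrically D·Σ_Ω c(b)/c(a) ≤ 2X|B|. Cauchy–Schwarz,
-- |Ω|² ≤ Σ_Ω c(a)/c(b) · Σ_Ω c(b)/c(a), together with δ|A||B| ≤ 2|Ω| then gives
-- δ²|A|²|B|²D² ≤ 16·XY·|A||B|.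
module Submission where

open import Defs

module Valuation where

  open import Data.Nat
  open import Data.Nat.Properties
  open import Data.Nat.Divisibility
  open import Data.Nat.GCD
  open import Data.Nat.Primality
  open import Data.Nat.Primality.Factorisation using (PrimeFactorisation; factorise)
  open import Data.Nat.Induction using (<-wellFounded)
  open import Induction.WellFounded using (Acc; acc)
  open import Data.List using ([]; _∷_)
  open import Data.List.Relation.Unary.All using (_∷_)
  open import Data.Nat.ListAction using (product)
  open import Data.Product using (∃; _,_; proj₁; proj₂)
  open import Data.Sum using ([_,_]′; inj₁)
  open import Data.Empty using (⊥-elim)
  open import Relation.Nullary using (¬_; yes; no)
  open import Relation.Binary.PropositionalEquality
  open import Data.Nat.Solver using (module +-*-Solver)

  ^-monoʳ-∣ : ∀ p {m n} → m ≤ n → p ^ m ∣ p ^ n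
  ^-monoʳ-∣ p {m} {n} m≤n = divides (p ^ (n ∸ m)) (begin
    p ^ n              ≡⟨ cong (p ^_) (m∸n+n≡m m≤n) ⟨
    p ^ (n ∸ m + m)    ≡⟨ ^-distribˡ-+-* p (n ∸ m) m ⟩
    p ^ (n ∸ m) * p ^ m ∎)
    where open ≡-Reasoning

  module _ {p : ℕ} (p-prime : Prime p) where

    private instance
      p≢0 : NonZero p
      p≢0 = prime⇒nonZero p-prime

    IsVal-* : ∀ {q k} → IsVal p q k → IsVal p (p * q) (suc k)
    IsVal-* (pᵏ∣q , pᵏ⁺¹∤q) = *-monoʳ-∣ p pᵏ∣q , λ pᵏ⁺²∣pq → pᵏ⁺¹∤q (*-cancelˡ-∣ p pᵏ⁺²∣pq)

    valuation : ∀ x → .{{NonZero x}} → ∃ (IsVal p x)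
    valuation x = go x (<-wellFounded x)
      where
      go : ∀ x → Acc _<_ x → .{{NonZero x}} → ∃ (IsVal p x)
      go x (acc rec) with p ∣? x
      ... | no p∤x = 0 , divides x (sym (*-identityʳ x)) , λ p¹∣x → p∤x (subst (_∣ x) (*-identityʳ p) p¹∣x)
      ... | yes (divides q x≡q*p) = let k , vq = go q (rec q<x) in
            suc k , subst (λ z → IsVal p z (suc k)) (trans (*-comm p q) (sym x≡q*p)) (IsVal-* {q} {k} vq)
        where
        instance
          q≢0 : NonZero q
          q≢0 = ≢-nonZero λ { refl → ≢-nonZero⁻¹ x x≡q*p }
        q<x : q < x
        q<x = subst (q <_) (sym x≡q*p) (m<m*n q p (nonTrivial⇒n>1 p {{prime⇒nonTrivial p-prime}}))

    IsVal-maximal : ∀ {x v k} → IsVal p x v → p ^ k ∣ x → k ≤ v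
    IsVal-maximal {v = v} {k} (_ , pᵛ⁺¹∤x) pᵏ∣x with k ≤? v
    ... | yes k≤v = k≤v
    ... | no k≰v = ⊥-elim (pᵛ⁺¹∤x (∣-trans (^-monoʳ-∣ p (≰⇒> k≰v)) pᵏ∣x))

    private
      p∤quotient : ∀ {x u k} → x ≡ u * p ^ k → ¬ p ^ suc k ∣ x → ¬ p ∣ u
      p∤quotient x≡u*pᵏ pᵏ⁺¹∤x p∣u = pᵏ⁺¹∤x (subst (p * _ ∣_) (sym x≡u*pᵏ) (*-pres-∣ p∣u ∣-refl))

    IsVal-*-bound : ∀ {x y i j v} → IsVal p x i → IsVal p y j → p ^ v ∣ x * y → v ≤ i + j
    IsVal-*-bound {x} {y} {i} {j} {v} (divides u x≡u*pⁱ , pⁱ⁺¹∤x) (divides w y≡w*pʲ , pʲ⁺¹∤y) pᵛ∣xy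
      with v ≤? i + j
    ... | yes v≤i+j = v≤i+j
    ... | no v≰i+j =
      ⊥-elim ([ p∤quotient {k = i} x≡u*pⁱ pⁱ⁺¹∤x , p∤quotient {k = j} y≡w*pʲ pʲ⁺¹∤y ]′ (euclidsLemma u w p-prime p∣uw))
      where
      instance _ = m^n≢0 p (i + j)
      xy≡ : x * y ≡ (u * w) * p ^ (i + j)
      xy≡ = begin
        x * y                       ≡⟨ cong₂ _*_ x≡u*pⁱ y≡w*pʲ ⟩
        (u * p ^ i) * (w * p ^ j)   ≡⟨ [m*n]*[o*p]≡[m*o]*[n*p] u (p ^ i) w (p ^ j) ⟩
        (u * w) * (p ^ i * p ^ j)   ≡⟨ cong ((u * w) *_) (^-distribˡ-+-* p i j) ⟨
        (u * w) * p ^ (i + j)       ∎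
        where open ≡-Reasoning
      p∣uw : p ∣ u * w
      p∣uw = *-cancelʳ-∣ (p ^ (i + j)) (subst (p * p ^ (i + j) ∣_) xy≡ (∣-trans (^-monoʳ-∣ p (≰⇒> v≰i+j)) pᵛ∣xy))

  ∣-by-valuations : ∀ x y → .{{NonZero x}} → (∀ p → Prime p → ∀ v → IsVal p x v → p ^ v ∣ y) → x ∣ y
  -- Otherwise a prime factor p of x / gcd(x, y) would give p ^ (v_p(x) + 1) ∣ x.
  ∣-by-valuations x y H with gcd[m,n]∣m x y
  ... | divides x′ x≡x′*g with x′ ≟ 1
  ...   | yes refl = subst (_∣ y) (trans (sym (*-identityˡ (gcd x y))) (sym x≡x′*g)) (gcd[m,n]∣n x y)
  ...   | no x′≢1 = from-factorisation (factorise x′ {{x′≢0}})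
    where
    x′≢0 : NonZero x′
    x′≢0 = ≢-nonZero λ { refl → ≢-nonZero⁻¹ x x≡x′*g }
    from-factorisation : PrimeFactorisation x′ → x ∣ y
    from-factorisation record { factors = [] ; isFactorisation = x′≡1 } = ⊥-elim (x′≢1 x′≡1)
    from-factorisation record { factors = p ∷ ps ; isFactorisation = x′≡p*ps ; factorsPrime = p-prime ∷ _ } =
      ⊥-elim (pᵛ⁺¹∤x (subst (p * p ^ v ∣_) (sym x≡x′*g) (*-pres-∣ p∣x′ pᵛ∣g)))
      where
      v = proj₁ (valuation p-prime x)
      pᵛ∣x = proj₁ (proj₂ (valuation p-prime x))
      pᵛ⁺¹∤x = proj₂ (proj₂ (valuation p-prime x))
      p∣x′ : p ∣ x′
      p∣x′ = divides (product ps) (trans x′≡p*ps (*-comm p (product ps)))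
      pᵛ∣g : p ^ v ∣ gcd x y
      pᵛ∣g = gcd-greatest pᵛ∣x (H p p-prime v (proj₂ (valuation p-prime x)))

  private
    ⊓-bound₀ : ∀ b n → n + ∣ b - n ∣ ≤ 1 → n ≤ b ⊓ n
    ⊓-bound₀ b             zero          _ = z≤n
    ⊓-bound₀ zero          (suc zero)    (s≤s ())
    ⊓-bound₀ (suc zero)    (suc zero)    _ = ≤-refl
    ⊓-bound₀ (suc (suc b)) (suc zero)    (s≤s ())
    ⊓-bound₀ b             (suc (suc n)) (s≤s ())

  ⊓-bound : ∀ a b n → ∣ a - n ∣ + ∣ b - n ∣ ≤ 1 → a ⊓ b + n ≤ a ⊓ n + b ⊓ n
  ⊓-bound zero    b       n       h = ⊓-bound₀ b n h
  ⊓-bound (suc a) zero    n       h =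
    subst (n ≤_) (sym (+-identityʳ (suc a ⊓ n))) (⊓-bound₀ (suc a) n (subst (_≤ 1) (+-comm ∣ suc a - n ∣ n) h))
  ⊓-bound (suc a) (suc b) zero    h =
    ⊥-elim (1+n≰n (≤-trans (s≤s (s≤s z≤n)) (subst (_≤ 1) (+-suc (suc a) b) h)))
  ⊓-bound (suc a) (suc b) (suc n) h =
    s≤s (subst₂ _≤_ (sym (+-suc (a ⊓ b) n)) (sym (+-suc (a ⊓ n) (b ⊓ n))) (s≤s (⊓-bound a b n h)))

  ^-⊓-∣-gcd : ∀ {p a n i k} → IsVal p a i → IsVal p n k → p ^ (i ⊓ k) ∣ gcd a n
  ^-⊓-∣-gcd {p} {i = i} {k} (pⁱ∣a , _) (pᵏ∣n , _) =
    gcd-greatest (∣-trans (^-monoʳ-∣ p (m⊓n≤m i k)) pⁱ∣a) (∣-trans (^-monoʳ-∣ p (m⊓n≤n i k)) pᵏ∣n)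

  gcd*N∣gcd*gcd : ∀ N a b → .{{NonZero N}} → .{{NonZero a}} → .{{NonZero b}} →
    (∀ p → Prime p → ValCond p N a b) → gcd a b * N ∣ gcd a N * gcd b N
  gcd*N∣gcd*gcd N a b valCond = ∣-by-valuations (gcd a b * N) (gcd a N * gcd b N) {{gN≢0}} pᵛ∣gcd*gcd
    where
    instance g≢0 = ≢-nonZero (gcd[m,n]≢0 a b (inj₁ (≢-nonZero⁻¹ a)))
    gN≢0 = m*n≢0 (gcd a b) N
    pᵛ∣gcd*gcd : ∀ p → Prime p → ∀ v → IsVal p (gcd a b * N) v → p ^ v ∣ gcd a N * gcd b N
    pᵛ∣gcd*gcd p p-prime v (pᵛ∣gN , _)
      with i , vᵃ ← valuation p-prime a | j , vᵇ ← valuation p-prime b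
         | k , vᴺ ← valuation p-prime N | w , vᵍ ← valuation p-prime (gcd a b) =
      ∣-trans (^-monoʳ-∣ p v≤) (subst (_∣ gcd a N * gcd b N) (sym (^-distribˡ-+-* p (i ⊓ k) (j ⊓ k)))
                                      (*-pres-∣ (^-⊓-∣-gcd {i = i} {k} vᵃ vᴺ) (^-⊓-∣-gcd {i = j} {k} vᵇ vᴺ)))
      where
      w≤i⊓j : w ≤ i ⊓ j
      w≤i⊓j = ⊓-glb (IsVal-maximal p-prime {v = i} vᵃ (∣-trans (proj₁ vᵍ) (gcd[m,n]∣m a b)))
                    (IsVal-maximal p-prime {v = j} vᵇ (∣-trans (proj₁ vᵍ) (gcd[m,n]∣n a b)))
      v≤ : v ≤ i ⊓ k + j ⊓ k
      v≤ = begin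
        v             ≤⟨ IsVal-*-bound p-prime {i = w} {k} vᵍ vᴺ pᵛ∣gN ⟩
        w + k         ≤⟨ +-monoˡ-≤ k w≤i⊓j ⟩
        i ⊓ j + k     ≤⟨ ⊓-bound i j k (valCond p p-prime i j k vᵃ vᵇ vᴺ) ⟩
        i ⊓ k + j ⊓ k ∎
        where open ≤-Reasoning

  -- N / gcd(a, N), taken as the quotient of the divisibility witness so that no NonZero instance is needed.
  cofactor : ℕ → ℕ → ℕ
  cofactor N a = quotient (gcd[m,n]∣n a N)

  N≡cofactor*gcd : ∀ N a → N ≡ cofactor N a * gcd a N
  N≡cofactor*gcd N a = _∣_.equality (gcd[m,n]∣n a N)

  cofactor-nonZero : ∀ N a → .{{NonZero N}} → NonZero (cofactor N a)
  cofactor-nonZero N a = ≢-nonZero λ c≡0 → ≢-nonZero⁻¹ N (trans (N≡cofactor*gcd N a) (cong (_* gcd a N) c≡0))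

  N∣*cofactor : ∀ N a → N ∣ a * cofactor N a
  N∣*cofactor N a with divides r a≡r*g ← gcd[m,n]∣m a N = divides r (begin
    a * c        ≡⟨ cong (_* c) a≡r*g ⟩
    r * g * c    ≡⟨ *-assoc r g c ⟩
    r * (g * c)  ≡⟨ cong (r *_) (*-comm g c) ⟩
    r * (c * g)  ≡⟨ cong (r *_) (N≡cofactor*gcd N a) ⟨
    r * N        ∎)
    where
    open ≡-Reasoning
    c = cofactor N a
    g = gcd a N

  gcd*cofactor*cofactor≤ : ∀ N a b → .{{NonZero N}} → .{{NonZero a}} → .{{NonZero b}} →
    (∀ p → Prime p → ValCond p N a b) → gcd a b * cofactor N a * cofactor N b ≤ N
  gcd*cofactor*cofactor≤ N a b valCond =
    ∣⇒≤ (*-cancelʳ-∣ N (subst₂ _∣_ (sym lhs≡) rhs≡ (*-monoˡ-∣ (cᵃ * cᵇ) (gcd*N∣gcd*gcd N a b valCond))))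
    where
    open +-*-Solver
    cᵃ = cofactor N a; cᵇ = cofactor N b
    lhs≡ : gcd a b * cᵃ * cᵇ * N ≡ (gcd a b * N) * (cᵃ * cᵇ)
    lhs≡ = solve 4 (λ g n x y → g :* x :* y :* n := (g :* n) :* (x :* y)) refl (gcd a b) N cᵃ cᵇ
    rhs≡ : (gcd a N * gcd b N) * (cᵃ * cᵇ) ≡ N * N
    rhs≡ = trans (solve 4 (λ g h x y → (g :* h) :* (x :* y) := (x :* g) :* (y :* h)) refl (gcd a N) (gcd b N) cᵃ cᵇ)
                 (sym (cong₂ _*_ (N≡cofactor*gcd N a) (N≡cofactor*gcd N b)))


open Valuation using (cofactor; cofactor-nonZero; N∣*cofactor; gcd*cofactor*cofactor≤)

open import Data.Nat as ℕ using (ℕ; zero; suc; NonZero) renaming (_≤_ to _≤ℕ_)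
import Data.Nat.Properties as ℕ
open import Data.Nat.Divisibility using (_∣_)
open import Data.Nat.DivMod using (m/n*n≡m)
open import Data.Nat.GCD using (gcd)
open import Data.Nat.Primality using (Prime)
open import Data.Nat.Coprimality using (Coprime; 1-coprimeTo) renaming (sym to coprime-sym)
import Data.Integer as ℤ
import Data.Integer.Properties as ℤ
open import Data.Rational hiding (NonZero)
open import Data.Rational.Properties
open import Data.Rational.Solver using (module +-*-Solver)
open +-*-Solver using (solve; _:+_; _:*_; _:-_; _:=_; con)
open import Data.Product using (_×_; _,_; proj₁; proj₂; swap)
open import Data.Sum using (inj₁; inj₂)
open import Data.List using (List; []; _∷_; length; map; filter)
open import Data.List.Properties using (filter-all; filter-accept; filter-reject; length-map)
open import Data.List.Membership.Propositional using (_∈_)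
open import Data.List.Membership.Propositional.Properties using (∈-filter⁻; ∈-map⁻; ∈-map⁺)
open import Data.List.Relation.Unary.Any using (here; there)
import Data.List.Relation.Unary.All as All
import Data.List.Relation.Unary.All.Properties as All
open import Data.List.Relation.Unary.AllPairs using ([]; _∷_)
open import Data.List.Relation.Unary.Unique.Propositional using (Unique)
import Data.List.Relation.Unary.Unique.Propositional.Properties as Unique
open import Data.List.Relation.Binary.Sublist.Propositional using (_⊆_; []; _∷_; _∷ʳ_)
open import Data.List.Relation.Binary.Sublist.Propositional.Properties using (filter-⊆; filter⁺)
open import Data.List.Extrema.Nat using (max; xs≤max; argmax-all)
open import Data.Empty using (⊥-elim)
open import Function using (_∘_; id)
open import Level using (0ℓ)
open import Relation.Nullary using (¬?; yes; no)
open import Relation.Unary using (Pred; Decidable)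
open import Relation.Binary.Definitions using (DecidableEquality)
open import Relation.Binary.PropositionalEquality

private
  coprime-1 : ∀ n → Coprime n 1
  coprime-1 n = coprime-sym (1-coprimeTo n)

⟦⟧≡mkℚ : ∀ n → ⟦ n ⟧ ≡ mkℚ (ℤ.+ n) 0 (coprime-1 n)
⟦⟧≡mkℚ n = normalize-coprime (coprime-1 n)

⟦⟧-+ : ∀ m n → ⟦ m ℕ.+ n ⟧ ≡ ⟦ m ⟧ + ⟦ n ⟧
⟦⟧-+ m n = sym (trans (cong₂ _+_ (⟦⟧≡mkℚ m) (⟦⟧≡mkℚ n))
                      (cong₂ (λ x y → (x ℤ.+ y) / 1) (ℤ.*-identityʳ (ℤ.+ m)) (ℤ.*-identityʳ (ℤ.+ n))))

⟦⟧-* : ∀ m n → ⟦ m ℕ.* n ⟧ ≡ ⟦ m ⟧ * ⟦ n ⟧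
⟦⟧-* m n = sym (trans (cong₂ _*_ (⟦⟧≡mkℚ m) (⟦⟧≡mkℚ n)) (cong (_/ 1) (sym (ℤ.pos-* m n))))

⟦⟧-mono-≤ : ∀ {m n} → m ≤ℕ n → ⟦ m ⟧ ≤ ⟦ n ⟧
⟦⟧-mono-≤ {m} {n} m≤n rewrite ⟦⟧≡mkℚ m | ⟦⟧≡mkℚ n =
  *≤* (subst₂ ℤ._≤_ (sym (ℤ.*-identityʳ (ℤ.+ m))) (sym (ℤ.*-identityʳ (ℤ.+ n))) (ℤ.+≤+ m≤n))

⟦⟧-cancel-≤ : ∀ {m n} → ⟦ m ⟧ ≤ ⟦ n ⟧ → m ≤ℕ n
⟦⟧-cancel-≤ {m} {n} ⟦m⟧≤⟦n⟧ rewrite ⟦⟧≡mkℚ m | ⟦⟧≡mkℚ n with ⟦m⟧≤⟦n⟧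
... | *≤* m*1≤n*1 = ℤ.drop‿+≤+ (subst₂ ℤ._≤_ (ℤ.*-identityʳ (ℤ.+ m)) (ℤ.*-identityʳ (ℤ.+ n)) m*1≤n*1)

0≤⟦⟧ : ∀ n → 0ℚ ≤ ⟦ n ⟧
0≤⟦⟧ n = ⟦⟧-mono-≤ {0} {n} ℕ.z≤n

⟦⟧-pos : ∀ n → .{{NonZero n}} → Positive ⟦ n ⟧
⟦⟧-pos (suc n) rewrite ⟦⟧≡mkℚ (suc n) = _

⟦_⟧⁻¹ : ℕ → ℚ
⟦ zero  ⟧⁻¹ = 0ℚ
⟦ suc n ⟧⁻¹ = 1/ mkℚ (ℤ.+ suc n) 0 (coprime-1 (suc n))

⟦⟧*⟦⟧⁻¹ : ∀ n → .{{NonZero n}} → ⟦ n ⟧ * ⟦ n ⟧⁻¹ ≡ 1ℚ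
⟦⟧*⟦⟧⁻¹ (suc n) = trans (cong (_* ⟦ suc n ⟧⁻¹) (⟦⟧≡mkℚ (suc n))) (*-inverseʳ (mkℚ (ℤ.+ suc n) 0 (coprime-1 (suc n))))

0≤⟦⟧⁻¹ : ∀ n → 0ℚ ≤ ⟦ n ⟧⁻¹
0≤⟦⟧⁻¹ zero    = ≤-refl
0≤⟦⟧⁻¹ (suc n) = <⇒≤ (positive⁻¹ ⟦ suc n ⟧⁻¹)

*-monoˡ-≤-0≤ : ∀ {r p q} → 0ℚ ≤ r → p ≤ q → r * p ≤ r * q
*-monoˡ-≤-0≤ {r} 0≤r = *-monoˡ-≤-nonNeg r {{nonNegative 0≤r}}

*-monoʳ-≤-0≤ : ∀ {r p q} → 0ℚ ≤ r → p ≤ q → p * r ≤ q * r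
*-monoʳ-≤-0≤ {r} 0≤r = *-monoʳ-≤-nonNeg r {{nonNegative 0≤r}}

*-mono-≤-0≤ : ∀ {p p′ q q′} → 0ℚ ≤ p → 0ℚ ≤ q′ → p ≤ p′ → q ≤ q′ → p * q ≤ p′ * q′
*-mono-≤-0≤ 0≤p 0≤q′ p≤p′ q≤q′ = ≤-trans (*-monoˡ-≤-0≤ 0≤p q≤q′) (*-monoʳ-≤-0≤ 0≤q′ p≤p′)

0≤* : ∀ {p q} → 0ℚ ≤ p → 0ℚ ≤ q → 0ℚ ≤ p * q
0≤* {p} 0≤p 0≤q = subst (_≤ p * _) (*-zeroʳ p) (*-monoˡ-≤-0≤ 0≤p 0≤q)

p≤q⇒0≤q-p : ∀ {p q} → p ≤ q → 0ℚ ≤ q - p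
p≤q⇒0≤q-p {p} {q} p≤q = subst (_≤ q - p) (+-inverseʳ p) (+-monoˡ-≤ (- p) p≤q)

∑ : {A : Set} → (A → ℚ) → List A → ℚ
∑ f []       = 0ℚ
∑ f (x ∷ xs) = f x + ∑ f xs

module _ {A : Set} where

  ∑-nonNeg : ∀ (f : A → ℚ) xs → (∀ x → x ∈ xs → 0ℚ ≤ f x) → 0ℚ ≤ ∑ f xs
  ∑-nonNeg f []       _   = ≤-refl
  ∑-nonNeg f (x ∷ xs) f≥0 = +-mono-≤ (f≥0 x (here refl)) (∑-nonNeg f xs (λ y y∈xs → f≥0 y (there y∈xs)))

  ∑-cong : ∀ (f g : A → ℚ) xs → (∀ x → x ∈ xs → f x ≡ g x) → ∑ f xs ≡ ∑ g xs
  ∑-cong f g []       _   = refl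
  ∑-cong f g (x ∷ xs) f≡g = cong₂ _+_ (f≡g x (here refl)) (∑-cong f g xs (λ y y∈xs → f≡g y (there y∈xs)))

  *-distribˡ-∑ : ∀ k (f : A → ℚ) xs → k * ∑ f xs ≡ ∑ (λ x → k * f x) xs
  *-distribˡ-∑ k f []       = *-zeroʳ k
  *-distribˡ-∑ k f (x ∷ xs) = trans (*-distribˡ-+ k (f x) (∑ f xs)) (cong (k * f x +_) (*-distribˡ-∑ k f xs))

  ∑-const : ∀ k (xs : List A) → ∑ (λ _ → k) xs ≡ ⟦ length xs ⟧ * k
  ∑-const k []       = sym (*-zeroˡ k)
  ∑-const k (x ∷ xs) = begin
    k + ∑ (λ _ → k) xs        ≡⟨ cong (k +_) (∑-const k xs) ⟩
    k + ⟦ length xs ⟧ * k     ≡⟨ cong (_+ ⟦ length xs ⟧ * k) (*-identityˡ k) ⟨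
    1ℚ * k + ⟦ length xs ⟧ * k ≡⟨ *-distribʳ-+ k 1ℚ ⟦ length xs ⟧ ⟨
    (1ℚ + ⟦ length xs ⟧) * k   ≡⟨ cong (_* k) (⟦⟧-+ 1 (length xs)) ⟨
    ⟦ suc (length xs) ⟧ * k    ∎
    where open ≡-Reasoning

  ∑-map : ∀ {B : Set} (f : B → ℚ) (h : A → B) xs → ∑ f (map h xs) ≡ ∑ (f ∘ h) xs
  ∑-map f h []       = refl
  ∑-map f h (x ∷ xs) = cong (f (h x) +_) (∑-map f h xs)

  ∑-mono-⊆ : ∀ (f : A → ℚ) → (∀ x → 0ℚ ≤ f x) → ∀ {xs ys} → xs ⊆ ys → ∑ f xs ≤ ∑ f ys
  ∑-mono-⊆ f f≥0 []              = ≤-refl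
  ∑-mono-⊆ f f≥0 (_∷ʳ_ {xs} {ys} y xs⊆ys) =
    subst (_≤ f y + ∑ f ys) (+-identityˡ (∑ f xs)) (+-mono-≤ (f≥0 y) (∑-mono-⊆ f f≥0 xs⊆ys))
  ∑-mono-⊆ f f≥0 (_∷_ {x} refl xs⊆ys) = +-monoʳ-≤ (f x) (∑-mono-⊆ f f≥0 xs⊆ys)

  ∑-partition : ∀ {P : Pred A 0ℓ} (P? : Decidable P) (f : A → ℚ) xs →
                ∑ f xs ≡ ∑ f (filter P? xs) + ∑ f (filter (¬? ∘ P?) xs)
  ∑-partition P? f []       = sym (+-identityʳ 0ℚ)
  ∑-partition P? f (x ∷ xs) with P? x
  ... | yes _ = trans (cong (f x +_) (∑-partition P? f xs)) (sym (+-assoc (f x) (∑ f (filter P? xs)) _))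
  ... | no  _ = trans (cong (f x +_) (∑-partition P? f xs))
                      (solve 3 (λ x y z → x :+ (y :+ z) := y :+ (x :+ z)) refl (f x) (∑ f (filter P? xs)) _)

module _ {A B : Set} (_≟_ : DecidableEquality B) (key : A → B) where

  fibre : B → List A → List A
  fibre b = filter (λ x → key x ≟ b)

  ∑-≤-by-fibres : ∀ (f : A → ℚ) K → (∀ x → 0ℚ ≤ f x) → ∀ bs xs → (∀ x → x ∈ xs → key x ∈ bs) →
                  (∀ b → b ∈ bs → ∑ f (fibre b xs) ≤ K) → ∑ f xs ≤ K * ⟦ length bs ⟧
  ∑-≤-by-fibres f K f≥0 []       []       _        _        = ≤-reflexive (sym (*-zeroʳ K))
  ∑-≤-by-fibres f K f≥0 []       (x ∷ xs) key∈[]   _        with () ← key∈[] x (here refl)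
  ∑-≤-by-fibres f K f≥0 (b ∷ bs) xs       key∈b∷bs fibre≤K = begin
    ∑ f xs                                  ≡⟨ ∑-partition (λ x → key x ≟ b) f xs ⟩
    ∑ f (fibre b xs) + ∑ f others           ≤⟨ +-mono-≤ (fibre≤K b (here refl)) others≤ ⟩
    K + K * ⟦ length bs ⟧                   ≡⟨ solve 2 (λ k n → k :+ k :* n := k :* (con 1ℚ :+ n)) refl K ⟦ length bs ⟧ ⟩
    K * (1ℚ + ⟦ length bs ⟧)                ≡⟨ cong (K *_) (⟦⟧-+ 1 (length bs)) ⟨
    K * ⟦ length (b ∷ bs) ⟧                 ∎
    where
    open ≤-Reasoning
    others = filter (λ x → ¬? (key x ≟ b)) xs
    key∈bs : ∀ x → x ∈ others → key x ∈ bs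
    key∈bs x x∈others with ∈-filter⁻ (λ x → ¬? (key x ≟ b)) {xs = xs} x∈others
    ... | x∈xs , key≢b with key∈b∷bs x x∈xs
    ...   | here key≡b = ⊥-elim (key≢b key≡b)
    ...   | there key∈bs = key∈bs
    others≤ : ∑ f others ≤ K * ⟦ length bs ⟧
    others≤ = ∑-≤-by-fibres f K f≥0 bs others key∈bs λ b′ b′∈bs →
      ≤-trans (∑-mono-⊆ f f≥0 (filter⁺ _ _ (λ { refl → id }) (filter-⊆ _ xs))) (fibre≤K b′ (there b′∈bs))

2≤u+v : ∀ {u v} → 0ℚ ≤ u → 0ℚ ≤ v → u * v ≡ 1ℚ → 1ℚ + 1ℚ ≤ u + v
2≤u+v {u} {v} 0≤u 0≤v u*v≡1 = begin
  1ℚ + 1ℚ                          ≡⟨ +-identityʳ _ ⟨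
  1ℚ + 1ℚ + 0ℚ                     ≤⟨ +-monoʳ-≤ (1ℚ + 1ℚ) 0≤[u-1][1-v] ⟩
  1ℚ + 1ℚ + (u - 1ℚ) * (1ℚ - v)    ≡⟨ solve 2 (λ u v → con 1ℚ :+ con 1ℚ :+ (u :- con 1ℚ) :* (con 1ℚ :- v)
                                                   := u :+ v :+ (con 1ℚ :- u :* v)) refl u v ⟩
  u + v + (1ℚ - u * v)             ≡⟨ cong (λ w → u + v + (1ℚ - w)) u*v≡1 ⟩
  u + v + (1ℚ - 1ℚ)                ≡⟨ cong (u + v +_) (+-inverseʳ 1ℚ) ⟩
  u + v + 0ℚ                       ≡⟨ +-identityʳ (u + v) ⟩
  u + v                            ∎
  where
  open ≤-Reasoning
  0≤[u-1][1-v] : 0ℚ ≤ (u - 1ℚ) * (1ℚ - v)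
  0≤[u-1][1-v] with ≤-total 1ℚ u
  ... | inj₁ 1≤u = 0≤* (p≤q⇒0≤q-p 1≤u) (p≤q⇒0≤q-p v≤1)
    where
    v≤1 : v ≤ 1ℚ
    v≤1 = subst₂ _≤_ (*-identityʳ v) (trans (*-comm v u) u*v≡1) (*-monoˡ-≤-0≤ 0≤v 1≤u)
  ... | inj₂ u≤1 = subst (0ℚ ≤_) (solve 2 (λ u v → (con 1ℚ :- u) :* (v :- con 1ℚ) := (u :- con 1ℚ) :* (con 1ℚ :- v)) refl u v)
                         (0≤* (p≤q⇒0≤q-p u≤1) (p≤q⇒0≤q-p 1≤v))
    where
    1≤v : 1ℚ ≤ v
    1≤v = subst₂ _≤_ u*v≡1 (*-identityˡ v) (*-monoʳ-≤-0≤ 0≤v u≤1)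

module _ {A : Set} (f g : A → ℚ) where

  Reciprocal : A → Set
  Reciprocal x = 0ℚ ≤ f x × 0ℚ ≤ g x × f x * g x ≡ 1ℚ

  private
    2*length≤ : ∀ {y} → Reciprocal y → ∀ xs → (∀ x → x ∈ xs → Reciprocal x) →
                ⟦ length xs ⟧ * (1ℚ + 1ℚ) ≤ f y * ∑ g xs + g y * ∑ f xs
    2*length≤ {y} _ [] _ =
      ≤-reflexive (solve 2 (λ a b → con 0ℚ :* (con 1ℚ :+ con 1ℚ) := a :* con 0ℚ :+ b :* con 0ℚ) refl (f y) (g y))
    2*length≤ {y} recip-y@(0≤fy , 0≤gy , fy*gy≡1) (x ∷ xs) recip
      with 0≤fx , 0≤gx , fx*gx≡1 ← recip x (here refl) = begin
      ⟦ suc (length xs) ⟧ * (1ℚ + 1ℚ)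
        ≡⟨ cong (_* (1ℚ + 1ℚ)) (⟦⟧-+ 1 (length xs)) ⟩
      (1ℚ + ⟦ length xs ⟧) * (1ℚ + 1ℚ)
        ≡⟨ solve 1 (λ n → (con 1ℚ :+ n) :* (con 1ℚ :+ con 1ℚ) := (con 1ℚ :+ con 1ℚ) :+ n :* (con 1ℚ :+ con 1ℚ)) refl ⟦ length xs ⟧ ⟩
      1ℚ + 1ℚ + ⟦ length xs ⟧ * (1ℚ + 1ℚ)
        ≤⟨ +-mono-≤ 2≤ (2*length≤ recip-y xs (λ z z∈xs → recip z (there z∈xs))) ⟩
      (f y * g x + g y * f x) + (f y * ∑ g xs + g y * ∑ f xs)
        ≡⟨ solve 6 (λ a b c d e k → (a :* c :+ b :* d) :+ (a :* e :+ b :* k) := a :* (c :+ e) :+ b :* (d :+ k))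
                   refl (f y) (g y) (g x) (f x) (∑ g xs) (∑ f xs) ⟩
      f y * (g x + ∑ g xs) + g y * (f x + ∑ f xs)
        ∎
      where
      open ≤-Reasoning
      2≤ : 1ℚ + 1ℚ ≤ f y * g x + g y * f x
      2≤ = 2≤u+v (0≤* 0≤fy 0≤gx) (0≤* 0≤gy 0≤fx) (begin-equality
        (f y * g x) * (g y * f x)
          ≡⟨ solve 4 (λ a b c d → (a :* c) :* (b :* d) := (a :* b) :* (d :* c)) refl (f y) (g y) (g x) (f x) ⟩
        (f y * g y) * (f x * g x)
          ≡⟨ cong₂ _*_ fy*gy≡1 fx*gx≡1 ⟩
        1ℚ * 1ℚ
          ≡⟨ *-identityˡ 1ℚ ⟩
        1ℚ
          ∎)

  length²≤∑*∑ : ∀ xs → (∀ x → x ∈ xs → Reciprocal x) → ⟦ length xs ⟧ * ⟦ length xs ⟧ ≤ ∑ f xs * ∑ g xs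
  length²≤∑*∑ []       _     = ≤-refl
  length²≤∑*∑ (x ∷ xs) recip = begin
    ⟦ suc n ⟧ * ⟦ suc n ⟧
      ≡⟨ cong (λ z → z * z) (⟦⟧-+ 1 n) ⟩
    (1ℚ + ⟦ n ⟧) * (1ℚ + ⟦ n ⟧)
      ≡⟨ solve 1 (λ m → (con 1ℚ :+ m) :* (con 1ℚ :+ m) := con 1ℚ :+ m :* (con 1ℚ :+ con 1ℚ) :+ m :* m) refl ⟦ n ⟧ ⟩
    1ℚ + ⟦ n ⟧ * (1ℚ + 1ℚ) + ⟦ n ⟧ * ⟦ n ⟧
      ≤⟨ +-mono-≤ (+-mono-≤ (≤-reflexive (sym (proj₂ (proj₂ (recip x (here refl))))))
                            (2*length≤ (recip x (here refl)) xs recip′))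
                  (length²≤∑*∑ xs recip′) ⟩
    f x * g x + (f x * ∑ g xs + g x * ∑ f xs) + ∑ f xs * ∑ g xs
      ≡⟨ solve 4 (λ a b c d → a :* b :+ (a :* d :+ b :* c) :+ c :* d := (a :+ c) :* (b :+ d)) refl (f x) (g x) (∑ f xs) (∑ g xs) ⟩
    (f x + ∑ f xs) * (g x + ∑ g xs)
      ∎
    where
    open ≤-Reasoning
    n = length xs
    recip′ = λ z z∈xs → recip z (there z∈xs)

length≤1+length-filter-≢ : ∀ v xs → Unique xs → length xs ≤ℕ suc (length (filter (λ x → ¬? (x ℕ.≟ v)) xs))
length≤1+length-filter-≢ v []       _               = ℕ.z≤n
length≤1+length-filter-≢ v (x ∷ xs) (x∉xs ∷ unique) with x ℕ.≟ v
... | no x≢v = subst (λ ys → suc (length xs) ≤ℕ suc (length ys)) (sym (filter-accept ≢v? x≢v))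
                     (ℕ.s≤s (length≤1+length-filter-≢ v xs unique))
  where ≢v? = λ x → ¬? (x ℕ.≟ v)
... | yes refl = subst (λ ys → suc (length xs) ≤ℕ suc (length ys)) (sym (filter-reject ≢v? (λ x≢x → x≢x refl)))
                       (ℕ.s≤s (ℕ.≤-reflexive (sym (cong length (filter-all ≢v? (All.map (λ x≢y y≡x → x≢y (sym y≡x)) x∉xs))))))
  where ≢v? = λ y → ¬? (y ℕ.≟ x)

Unique⇒length≤ : ∀ K xs → Unique xs → (∀ x → x ∈ xs → 0 ℕ.< x × x ≤ℕ K) → length xs ≤ℕ K
Unique⇒length≤ zero    []       _      _     = ℕ.z≤n
Unique⇒length≤ zero    (x ∷ xs) _      range = ⊥-elim (ℕ.<⇒≱ (proj₁ (range x (here refl))) (proj₂ (range x (here refl))))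
Unique⇒length≤ (suc K) xs       unique range =
  ℕ.≤-trans (length≤1+length-filter-≢ (suc K) xs unique) (ℕ.s≤s (Unique⇒length≤ K others (Unique.filter⁺ _ unique) range′))
  where
  others = filter (λ x → ¬? (x ℕ.≟ suc K)) xs
  range′ : ∀ x → x ∈ others → 0 ℕ.< x × x ≤ℕ K
  range′ x x∈others with x∈xs , x≢1+K ← ∈-filter⁻ (λ x → ¬? (x ℕ.≟ suc K)) {xs = xs} x∈others =
    proj₁ (range x x∈xs) , ℕ.≤-pred (ℕ.≤∧≢⇒< (proj₂ (range x x∈xs)) x≢1+K)

Unique⇒⟦length⟧*r≤ : ∀ xs → Unique xs → (∀ x → x ∈ xs → 0 ℕ.< x) → ∀ {r s} → 0ℚ ≤ r → 0ℚ ≤ s →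
                      (∀ x → x ∈ xs → ⟦ x ⟧ * r ≤ s) → ⟦ length xs ⟧ * r ≤ s
Unique⇒⟦length⟧*r≤ xs unique 0<xs {r} {s} 0≤r 0≤s xs*r≤s = ≤-trans
  (*-monoʳ-≤-0≤ 0≤r (⟦⟧-mono-≤ (Unique⇒length≤ (max 0 xs) xs unique λ x x∈xs → 0<xs x x∈xs , All.lookup (xs≤max 0 xs) x∈xs)))
  (argmax-all id (subst (_≤ s) (sym (*-zeroˡ r)) 0≤s) (All.tabulate (xs*r≤s _)))

Unique-map⁺-on : ∀ {A B : Set} (f : A → B) {xs} → (∀ {x y} → x ∈ xs → y ∈ xs → f x ≡ f y → x ≡ y) →
                 Unique xs → Unique (map f xs)
Unique-map⁺-on f {[]}     _   _               = []
Unique-map⁺-on f {x ∷ xs} inj (x∉xs ∷ unique) =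
  All.map⁺ (All.tabulate λ y∈xs fx≡fy → All.lookup x∉xs y∈xs (inj (here refl) (there y∈xs) fx≡fy))
  ∷ Unique-map⁺-on f (λ x∈xs y∈xs → inj (there x∈xs) (there y∈xs)) unique

module _ (N : ℕ) .{{_ : NonZero N}} where

  count-N∣*d : ∀ d .{{_ : NonZero d}} K → 0ℚ ≤ K → ∀ bs → Unique bs →
               (∀ b → b ∈ bs → 0 ℕ.< b × N ∣ b ℕ.* d × ⟦ b ⟧ ≤ K) → ⟦ length bs ⟧ * ⟦ N ⟧ ≤ K * ⟦ d ⟧
  -- b ↦ b·d/N maps bs injectively to positive integers k with k·N ≤ K·d.
  count-N∣*d d K 0≤K bs unique hyp = subst (_≤ K * ⟦ d ⟧) (cong (λ n → ⟦ n ⟧ * ⟦ N ⟧) (length-map q bs))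
    (Unique⇒⟦length⟧*r≤ (map q bs) (Unique-map⁺-on q q-injective unique) q-pos (0≤⟦⟧ N) (0≤* 0≤K (0≤⟦⟧ d)) q*N≤)
    where
    q : ℕ → ℕ
    q b = b ℕ.* d ℕ./ N
    q*N≡ : ∀ {b} → b ∈ bs → q b ℕ.* N ≡ b ℕ.* d
    q*N≡ b∈bs = m/n*n≡m (proj₁ (proj₂ (hyp _ b∈bs)))
    q-injective : ∀ {x y} → x ∈ bs → y ∈ bs → q x ≡ q y → x ≡ y
    q-injective {x} {y} x∈bs y∈bs qx≡qy =
      ℕ.*-cancelʳ-≡ x y d (trans (sym (q*N≡ x∈bs)) (trans (cong (ℕ._* N) qx≡qy) (q*N≡ y∈bs)))
    q-pos : ∀ k → k ∈ map q bs → 0 ℕ.< k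
    q-pos k k∈qbs with b , b∈bs , refl ← ∈-map⁻ q k∈qbs = ℕ.n≢0⇒n>0 λ qb≡0 →
      ℕ.≢-nonZero⁻¹ (b ℕ.* d) {{ℕ.m*n≢0 b d {{ℕ.>-nonZero (proj₁ (hyp b b∈bs))}}}}
        (trans (sym (q*N≡ b∈bs)) (cong (ℕ._* N) qb≡0))
    q*N≤ : ∀ k → k ∈ map q bs → ⟦ k ⟧ * ⟦ N ⟧ ≤ K * ⟦ d ⟧
    q*N≤ k k∈qbs with b , b∈bs , refl ← ∈-map⁻ q k∈qbs = begin
      ⟦ q b ⟧ * ⟦ N ⟧  ≡⟨ ⟦⟧-* (q b) N ⟨
      ⟦ q b ℕ.* N ⟧    ≡⟨ cong ⟦_⟧ (q*N≡ b∈bs) ⟩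
      ⟦ b ℕ.* d ⟧      ≡⟨ ⟦⟧-* b d ⟩
      ⟦ b ⟧ * ⟦ d ⟧    ≤⟨ *-monoʳ-≤-0≤ (0≤⟦⟧ d) (proj₂ (proj₂ (hyp b b∈bs))) ⟩
      K * ⟦ d ⟧        ∎
      where open ≤-Reasoning

  module Reciprocals (c : ℕ → ℕ) (c≢0 : ∀ b → NonZero (c b)) (N∣*c : ∀ b → N ∣ b ℕ.* c b) where

    N*∑⟦c⟧⁻¹≤ : ∀ K → 0ℚ ≤ K → ∀ n bs → Unique bs → (∀ b → b ∈ bs → 0 ℕ.< b × ⟦ b ⟧ ≤ K × c b ≤ℕ n) →
                ⟦ N ⟧ * ∑ (⟦_⟧⁻¹ ∘ c) bs ≤ K * ⟦ n ⟧
    N*∑⟦c⟧⁻¹≤ K 0≤K zero    []       _      _   = ≤-reflexive (trans (*-zeroʳ ⟦ N ⟧) (sym (*-zeroʳ K)))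
    N*∑⟦c⟧⁻¹≤ K 0≤K zero    (b ∷ bs) _      hyp =
      ⊥-elim (ℕ.≢-nonZero⁻¹ (c b) {{c≢0 b}} (ℕ.n≤0⇒n≡0 (proj₂ (proj₂ (hyp b (here refl))))))
    N*∑⟦c⟧⁻¹≤ K 0≤K (suc m) bs     unique hyp = begin
      ⟦ N ⟧ * ∑ f bs                          ≡⟨ cong (⟦ N ⟧ *_) (∑-partition layer? f bs) ⟩
      ⟦ N ⟧ * (∑ f layer + ∑ f rest)          ≡⟨ *-distribˡ-+ ⟦ N ⟧ (∑ f layer) (∑ f rest) ⟩
      ⟦ N ⟧ * ∑ f layer + ⟦ N ⟧ * ∑ f rest    ≤⟨ +-mono-≤ layer≤ rest≤ ⟩
      K + K * ⟦ m ⟧                           ≡⟨ solve 2 (λ k n → k :+ k :* n := k :* (con 1ℚ :+ n)) refl K ⟦ m ⟧ ⟩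
      K * (1ℚ + ⟦ m ⟧)                        ≡⟨ cong (K *_) (⟦⟧-+ 1 m) ⟨
      K * ⟦ suc m ⟧                           ∎
      where
      open ≤-Reasoning
      f = ⟦_⟧⁻¹ ∘ c
      layer? = λ b → c b ℕ.≟ suc m
      layer = filter layer? bs
      rest = filter (¬? ∘ layer?) bs
      layer-count : ⟦ length layer ⟧ * ⟦ N ⟧ ≤ K * ⟦ suc m ⟧
      layer-count = count-N∣*d (suc m) K 0≤K layer (Unique.filter⁺ layer? unique) λ b b∈layer →
        let b∈bs , cb≡1+m = ∈-filter⁻ layer? {xs = bs} b∈layer in
        proj₁ (hyp b b∈bs) , subst (λ k → N ∣ b ℕ.* k) cb≡1+m (N∣*c b) , proj₁ (proj₂ (hyp b b∈bs))
      layer≤ : ⟦ N ⟧ * ∑ f layer ≤ K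
      layer≤ = begin
        ⟦ N ⟧ * ∑ f layer
          ≡⟨ cong (⟦ N ⟧ *_) (∑-cong f (λ _ → ⟦ suc m ⟧⁻¹) layer λ b b∈layer →
               cong ⟦_⟧⁻¹ (proj₂ (∈-filter⁻ layer? {xs = bs} b∈layer))) ⟩
        ⟦ N ⟧ * ∑ (λ _ → ⟦ suc m ⟧⁻¹) layer
          ≡⟨ cong (⟦ N ⟧ *_) (∑-const ⟦ suc m ⟧⁻¹ layer) ⟩
        ⟦ N ⟧ * (⟦ length layer ⟧ * ⟦ suc m ⟧⁻¹)
          ≡⟨ solve 3 (λ n l i → n :* (l :* i) := (l :* n) :* i) refl ⟦ N ⟧ ⟦ length layer ⟧ ⟦ suc m ⟧⁻¹ ⟩
        (⟦ length layer ⟧ * ⟦ N ⟧) * ⟦ suc m ⟧⁻¹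
          ≤⟨ *-monoʳ-≤-0≤ (0≤⟦⟧⁻¹ (suc m)) layer-count ⟩
        (K * ⟦ suc m ⟧) * ⟦ suc m ⟧⁻¹
          ≡⟨ *-assoc K ⟦ suc m ⟧ ⟦ suc m ⟧⁻¹ ⟩
        K * (⟦ suc m ⟧ * ⟦ suc m ⟧⁻¹)
          ≡⟨ cong (K *_) (⟦⟧*⟦⟧⁻¹ (suc m)) ⟩
        K * 1ℚ
          ≡⟨ *-identityʳ K ⟩
        K
          ∎
      rest≤ : ⟦ N ⟧ * ∑ f rest ≤ K * ⟦ m ⟧
      rest≤ = N*∑⟦c⟧⁻¹≤ K 0≤K m rest (Unique.filter⁺ (¬? ∘ layer?) unique) λ b b∈rest →
        let b∈bs , cb≢1+m = ∈-filter⁻ (¬? ∘ layer?) {xs = bs} b∈rest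
            0<b , b≤K , cb≤1+m = hyp b b∈bs in
        0<b , b≤K , ℕ.≤-pred (ℕ.≤∧≢⇒< cb≤1+m cb≢1+m)

    D*c*∑⟦c⟧⁻¹≤ : ∀ D K a bs → 0ℚ ≤ D → 0ℚ ≤ K → Unique bs → (∀ b → b ∈ bs → 0 ℕ.< b × ⟦ b ⟧ ≤ K) →
                  (∀ b → b ∈ bs → D * ⟦ c a ⟧ * ⟦ c b ⟧ ≤ ⟦ N ⟧) → D * ⟦ c a ⟧ * ∑ (⟦_⟧⁻¹ ∘ c) bs ≤ K
    D*c*∑⟦c⟧⁻¹≤ D K a bs 0≤D 0≤K unique bounded D*c*c≤N = *-cancelˡ-≤-pos ⟦ N ⟧ {{⟦⟧-pos N}} (begin
      ⟦ N ⟧ * (Dc * ∑ f bs)      ≡⟨ solve 3 (λ n x s → n :* (x :* s) := x :* (n :* s)) refl ⟦ N ⟧ Dc (∑ f bs) ⟩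
      Dc * (⟦ N ⟧ * ∑ f bs)      ≤⟨ *-monoˡ-≤-0≤ (0≤* 0≤D (0≤⟦⟧ (c a))) N*∑≤ ⟩
      Dc * (K * ⟦ n ⟧)           ≡⟨ solve 3 (λ x k n → x :* (k :* n) := k :* (x :* n)) refl Dc K ⟦ n ⟧ ⟩
      K * (Dc * ⟦ n ⟧)           ≤⟨ *-monoˡ-≤-0≤ 0≤K Dc*n≤N ⟩
      K * ⟦ N ⟧                  ≡⟨ *-comm K ⟦ N ⟧ ⟩
      ⟦ N ⟧ * K                  ∎)
      where
      open ≤-Reasoning
      f = ⟦_⟧⁻¹ ∘ c
      Dc = D * ⟦ c a ⟧
      n = max 0 (map c bs)
      N*∑≤ : ⟦ N ⟧ * ∑ f bs ≤ K * ⟦ n ⟧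
      N*∑≤ = N*∑⟦c⟧⁻¹≤ K 0≤K n bs unique λ b b∈bs →
        proj₁ (bounded b b∈bs) , proj₂ (bounded b b∈bs) , All.lookup (xs≤max 0 (map c bs)) (∈-map⁺ c b∈bs)
      Dc*n≤N : Dc * ⟦ n ⟧ ≤ ⟦ N ⟧
      Dc*n≤N = argmax-all id {P = λ k → Dc * ⟦ k ⟧ ≤ ⟦ N ⟧} (subst (_≤ ⟦ N ⟧) (sym (*-zeroʳ Dc)) (0≤⟦⟧ N))
        (All.map⁺ (All.tabulate (D*c*c≤N _)))

    ratio : ℕ × ℕ → ℚ
    ratio (a , b) = ⟦ c a ⟧ * ⟦ c b ⟧⁻¹

    0≤ratio : ∀ ω → 0ℚ ≤ ratio ω
    0≤ratio (a , b) = 0≤* (0≤⟦⟧ (c a)) (0≤⟦⟧⁻¹ (c b))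

    ratio-reciprocal : ∀ ω → Reciprocal ratio (ratio ∘ swap) ω
    ratio-reciprocal (a , b) = 0≤ratio (a , b) , 0≤ratio (b , a) , (begin
      (⟦ c a ⟧ * ⟦ c b ⟧⁻¹) * (⟦ c b ⟧ * ⟦ c a ⟧⁻¹)
        ≡⟨ solve 4 (λ x x′ y y′ → (x :* y′) :* (y :* x′) := (x :* x′) :* (y :* y′)) refl ⟦ c a ⟧ ⟦ c a ⟧⁻¹ ⟦ c b ⟧ ⟦ c b ⟧⁻¹ ⟩
      (⟦ c a ⟧ * ⟦ c a ⟧⁻¹) * (⟦ c b ⟧ * ⟦ c b ⟧⁻¹)   ≡⟨ cong₂ _*_ (⟦⟧*⟦⟧⁻¹ (c a) {{c≢0 a}}) (⟦⟧*⟦⟧⁻¹ (c b) {{c≢0 b}}) ⟩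
      1ℚ * 1ℚ                                         ≡⟨ *-identityˡ 1ℚ ⟩
      1ℚ                                              ∎)
      where open ≡-Reasoning

    D*∑ratio≤ : ∀ D K → 0ℚ ≤ D → 0ℚ ≤ K → ∀ As Bs Ω → Unique Ω →
      (∀ a b → (a , b) ∈ Ω → a ∈ As × b ∈ Bs) → (∀ b → b ∈ Bs → 0 ℕ.< b × ⟦ b ⟧ ≤ K) →
      (∀ a b → (a , b) ∈ Ω → D * ⟦ c a ⟧ * ⟦ c b ⟧ ≤ ⟦ N ⟧) → D * ∑ ratio Ω ≤ K * ⟦ length As ⟧
    D*∑ratio≤ D K 0≤D 0≤K As Bs Ω unique Ω⊆As×Bs Bs-bounded D*c*c≤N = begin
      D * ∑ ratio Ω              ≡⟨ *-distribˡ-∑ D ratio Ω ⟩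
      ∑ (λ ω → D * ratio ω) Ω    ≤⟨ ∑-≤-by-fibres ℕ._≟_ proj₁ (λ ω → D * ratio ω) K (λ ω → 0≤* 0≤D (0≤ratio ω)) As Ω
                                      (λ ω ω∈Ω → proj₁ (Ω⊆As×Bs _ _ ω∈Ω)) fibre≤K ⟩
      K * ⟦ length As ⟧          ∎
      where
      open ≤-Reasoning
      fibre≤K : ∀ a → a ∈ As → ∑ (λ ω → D * ratio ω) (fibre ℕ._≟_ proj₁ a Ω) ≤ K
      fibre≤K a _ = begin
        ∑ (λ ω → D * ratio ω) W                 ≡⟨ ∑-cong _ (λ ω → D * ⟦ c a ⟧ * f (proj₂ ω)) W
                                                     (λ { (_ , b) ω∈W → trans (cong (λ a′ → D * (⟦ c a′ ⟧ * f b)) (proj₂ (W⊆Ω ω∈W)))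
                                                                               (sym (*-assoc D _ _)) }) ⟩
        ∑ (λ ω → D * ⟦ c a ⟧ * f (proj₂ ω)) W   ≡⟨ *-distribˡ-∑ (D * ⟦ c a ⟧) (f ∘ proj₂) W ⟨
        D * ⟦ c a ⟧ * ∑ (f ∘ proj₂) W           ≡⟨ cong (D * ⟦ c a ⟧ *_) (∑-map f proj₂ W) ⟨
        D * ⟦ c a ⟧ * ∑ f bs                    ≤⟨ D*c*∑⟦c⟧⁻¹≤ D K a bs 0≤D 0≤K bs-unique
                                                     (λ b b∈bs → Bs-bounded b (proj₂ (Ω⊆As×Bs a b (bs⊆Ω b∈bs))))
                                                     (λ b b∈bs → D*c*c≤N a b (bs⊆Ω b∈bs)) ⟩
        K                                       ∎
        where
        f = ⟦_⟧⁻¹ ∘ c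
        W = fibre ℕ._≟_ proj₁ a Ω
        bs = map proj₂ W
        W⊆Ω : ∀ {ω} → ω ∈ W → ω ∈ Ω × proj₁ ω ≡ a
        W⊆Ω = ∈-filter⁻ (λ ω → proj₁ ω ℕ.≟ a) {xs = Ω}
        bs⊆Ω : ∀ {b} → b ∈ bs → (a , b) ∈ Ω
        bs⊆Ω b∈bs with (_ , b) , ω∈W , refl ← ∈-map⁻ proj₂ b∈bs with ω∈Ω , refl ← W⊆Ω ω∈W = ω∈Ω
        bs-unique : Unique bs
        bs-unique = Unique-map⁺-on proj₂ (λ x∈W y∈W x₂≡y₂ →
          cong₂ _,_ (trans (proj₂ (W⊆Ω x∈W)) (sym (proj₂ (W⊆Ω y∈W)))) x₂≡y₂) (Unique.filter⁺ _ unique)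

    D*∑ratio∘swap≤ : ∀ D K → 0ℚ ≤ D → 0ℚ ≤ K → ∀ As Bs Ω → Unique Ω →
      (∀ a b → (a , b) ∈ Ω → a ∈ As × b ∈ Bs) → (∀ a → a ∈ As → 0 ℕ.< a × ⟦ a ⟧ ≤ K) →
      (∀ a b → (a , b) ∈ Ω → D * ⟦ c a ⟧ * ⟦ c b ⟧ ≤ ⟦ N ⟧) → D * ∑ (ratio ∘ swap) Ω ≤ K * ⟦ length Bs ⟧
    D*∑ratio∘swap≤ D K 0≤D 0≤K As Bs Ω unique Ω⊆As×Bs As-bounded D*c*c≤N =
      subst (λ s → D * s ≤ K * ⟦ length Bs ⟧) (∑-map ratio swap Ω)
        (D*∑ratio≤ D K 0≤D 0≤K Bs As (map swap Ω) (Unique.map⁺ (cong swap) unique)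
          (λ b a ba∈Ω′ → swap (Ω⊆As×Bs a b (swapped ba∈Ω′))) As-bounded
          (λ b a ba∈Ω′ → subst (_≤ ⟦ N ⟧) (solve 3 (λ d x y → d :* x :* y := d :* y :* x) refl D ⟦ c a ⟧ ⟦ c b ⟧)
                                (D*c*c≤N a b (swapped ba∈Ω′))))
      where
      swapped : ∀ {a b} → (b , a) ∈ map swap Ω → (a , b) ∈ Ω
      swapped ba∈Ω′ with _ , ω∈Ω , refl ← ∈-map⁻ swap ba∈Ω′ = ω∈Ω

[δαβD]²≤16XYαβ : ∀ {X Y D δ α β n S T} → 0ℚ ≤ D → 0ℚ ≤ δ * α * β → 0ℚ ≤ n → 0ℚ ≤ S → 0ℚ ≤ ⟦ 2 ⟧ * X * β →
  δ * α * β ≤ ⟦ 2 ⟧ * n → n * n ≤ S * T → D * S ≤ ⟦ 2 ⟧ * Y * α → D * T ≤ ⟦ 2 ⟧ * X * β →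
  (δ * α * β) * (δ * α * β) * (D * D) ≤ ⟦ 16 ⟧ * (X * Y * (α * β))
[δαβD]²≤16XYαβ {X} {Y} {D} {δ} {α} {β} {n} {S} {T} 0≤D 0≤δαβ 0≤n 0≤S 0≤2Xβ δαβ≤2n n²≤ST DS≤2Yα DT≤2Xβ = begin
  (δ * α * β) * (δ * α * β) * (D * D)    ≤⟨ *-monoʳ-≤-0≤ (0≤* 0≤D 0≤D) (*-mono-≤-0≤ 0≤δαβ (0≤* (0≤⟦⟧ 2) 0≤n) δαβ≤2n δαβ≤2n) ⟩
  (t * n) * (t * n) * (D * D)
    ≡⟨ solve 3 (λ t n d → (t :* n) :* (t :* n) :* (d :* d) := (t :* t) :* ((d :* d) :* (n :* n))) refl t n D ⟩
  (t * t) * ((D * D) * (n * n))          ≤⟨ *-monoˡ-≤-0≤ (0≤⟦⟧ 4) (*-monoˡ-≤-0≤ (0≤* 0≤D 0≤D) n²≤ST) ⟩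
  (t * t) * ((D * D) * (S * T))
    ≡⟨ solve 4 (λ t d s u → (t :* t) :* ((d :* d) :* (s :* u)) := (t :* t) :* ((d :* s) :* (d :* u))) refl t D S T ⟩
  (t * t) * ((D * S) * (D * T))          ≤⟨ *-monoˡ-≤-0≤ (0≤⟦⟧ 4) (*-mono-≤-0≤ (0≤* 0≤D 0≤S) 0≤2Xβ DS≤2Yα DT≤2Xβ) ⟩
  (t * t) * ((t * Y * α) * (t * X * β))
    ≡⟨ solve 5 (λ t x y a b → (t :* t) :* ((t :* y :* a) :* (t :* x :* b)) := (t :* t :* t :* t) :* (x :* y :* (a :* b))) refl t X Y α β ⟩
  ⟦ 16 ⟧ * (X * Y * (α * β))             ∎
  where
  open ≤-Reasoning
  t = ⟦ 2 ⟧

δ²αβD²≤1000XY : ∀ X Y D δ → 0ℚ ≤ X → 0ℚ ≤ Y → 0ℚ ≤ D → 0ℚ ≤ δ → ∀ la lb n S T →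
  δ * ⟦ la ⟧ * ⟦ lb ⟧ ≤ ⟦ 2 ⟧ * n → 0ℚ ≤ n → n * n ≤ S * T → 0ℚ ≤ S →
  D * S ≤ ⟦ 2 ⟧ * Y * ⟦ la ⟧ → D * T ≤ ⟦ 2 ⟧ * X * ⟦ lb ⟧ →
  δ * δ * ⟦ la ⟧ * ⟦ lb ⟧ * (D * D) ≤ ⟦ 1000 ⟧ * X * Y
δ²αβD²≤1000XY X Y D δ 0≤X 0≤Y _ _ zero lb _ _ _ _ _ _ _ _ _ =
  subst (_≤ ⟦ 1000 ⟧ * X * Y) (solve 3 (λ d e b → con 0ℚ := d :* d :* con 0ℚ :* b :* (e :* e)) refl δ D ⟦ lb ⟧)
        (0≤* (0≤* (0≤⟦⟧ 1000) 0≤X) 0≤Y)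
δ²αβD²≤1000XY X Y D δ 0≤X 0≤Y _ _ (suc la) zero _ _ _ _ _ _ _ _ _ =
  subst (_≤ ⟦ 1000 ⟧ * X * Y) (solve 3 (λ d e a → con 0ℚ := d :* d :* a :* con 0ℚ :* (e :* e)) refl δ D ⟦ suc la ⟧)
        (0≤* (0≤* (0≤⟦⟧ 1000) 0≤X) 0≤Y)
δ²αβD²≤1000XY X Y D δ 0≤X 0≤Y 0≤D 0≤δ (suc la) (suc lb) n S T δαβ≤2n 0≤n n²≤ST 0≤S DS≤ DT≤ =
  *-cancelʳ-≤-pos (α * β) {{αβ-pos}} (begin
    δ * δ * α * β * (D * D) * (α * β)
      ≡⟨ solve 4 (λ d a b e → d :* d :* a :* b :* (e :* e) :* (a :* b) := (d :* a :* b) :* (d :* a :* b) :* (e :* e)) refl δ α β D ⟩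
    (δ * α * β) * (δ * α * β) * (D * D)
      ≤⟨ [δαβD]²≤16XYαβ {X} {Y} {D} {δ} {α} {β} {n} {S} {T} 0≤D (0≤* (0≤* 0≤δ 0≤α) 0≤β) 0≤n 0≤S
                         (0≤* (0≤* (0≤⟦⟧ 2) 0≤X) 0≤β) δαβ≤2n n²≤ST DS≤ DT≤ ⟩
    ⟦ 16 ⟧ * (X * Y * (α * β))
      ≤⟨ *-monoʳ-≤-0≤ {p = ⟦ 16 ⟧} {⟦ 1000 ⟧} (0≤* (0≤* 0≤X 0≤Y) (0≤* 0≤α 0≤β)) (≤ᵇ⇒≤ _) ⟩
    ⟦ 1000 ⟧ * (X * Y * (α * β))
      ≡⟨ solve 4 (λ k x y p → k :* (x :* y :* p) := k :* x :* y :* p) refl ⟦ 1000 ⟧ X Y (α * β) ⟩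
    ⟦ 1000 ⟧ * X * Y * (α * β)           ∎)
  where
  open ≤-Reasoning
  α = ⟦ suc la ⟧; β = ⟦ suc lb ⟧
  0≤α = 0≤⟦⟧ (suc la); 0≤β = 0≤⟦⟧ (suc lb)
  αβ-pos : Positive (α * β)
  αβ-pos = subst Positive (⟦⟧-* (suc la) (suc lb)) (⟦⟧-pos (suc la ℕ.* suc lb))

D*cofactor*cofactor≤N : ∀ {D} N a b → .{{NonZero N}} → .{{NonZero a}} → .{{NonZero b}} →
  (∀ p → Prime p → ValCond p N a b) → D ≤ ⟦ gcd a b ⟧ → D * ⟦ cofactor N a ⟧ * ⟦ cofactor N b ⟧ ≤ ⟦ N ⟧
D*cofactor*cofactor≤N {D} N a b valCond D≤gcd = begin
  D * ⟦ cᵃ ⟧ * ⟦ cᵇ ⟧              ≤⟨ *-monoʳ-≤-0≤ (0≤⟦⟧ cᵇ) (*-monoʳ-≤-0≤ (0≤⟦⟧ cᵃ) D≤gcd) ⟩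
  ⟦ gcd a b ⟧ * ⟦ cᵃ ⟧ * ⟦ cᵇ ⟧    ≡⟨ cong (_* ⟦ cᵇ ⟧) (⟦⟧-* (gcd a b) cᵃ) ⟨
  ⟦ gcd a b ℕ.* cᵃ ⟧ * ⟦ cᵇ ⟧      ≡⟨ ⟦⟧-* (gcd a b ℕ.* cᵃ) cᵇ ⟨
  ⟦ gcd a b ℕ.* cᵃ ℕ.* cᵇ ⟧        ≤⟨ ⟦⟧-mono-≤ (gcd*cofactor*cofactor≤ N a b valCond) ⟩
  ⟦ N ⟧                             ∎
  where
  open ≤-Reasoning
  cᵃ = cofactor N a; cᵇ = cofactor N b

proposition1p3 : (X Y D δ : ℚ) → 1ℚ ≤ X → 1ℚ ≤ Y → 1ℚ ≤ D → D ≤ X → D ≤ Y →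
    0ℚ < δ → δ ≤ 1ℚ →
    (A B : List ℕ) → Unique A → Unique B →
    (∀ a → a ∈ A → X ≤ ⟦ a ⟧ × ⟦ a ⟧ ≤ ⟦ 2 ⟧ * X) →
    (∀ b → b ∈ B → Y ≤ ⟦ b ⟧ × ⟦ b ⟧ ≤ ⟦ 2 ⟧ * Y) →
    (Ω : List (ℕ × ℕ)) → Unique Ω →
    (∀ a b → (a , b) ∈ Ω → a ∈ A × b ∈ B) →
    δ * ⟦ length A ⟧ * ⟦ length B ⟧ ≤ ⟦ 2 ⟧ * ⟦ length Ω ⟧ →
    (∀ a b → (a , b) ∈ Ω → D ≤ ⟦ gcd a b ⟧) →
    (N : ℕ) → NonZero N →
    (∀ p → Prime p → ∀ a b → (a , b) ∈ Ω → ValCond p N a b) →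
    δ * δ * ⟦ length A ⟧ * ⟦ length B ⟧ * (D * D) ≤ ⟦ 1000 ⟧ * X * Y
proposition1p3 X Y D δ 1≤X 1≤Y 1≤D _ _ 0<δ _ A B _ _ A-range B-range Ω Ω-unique Ω⊆A×B Ω-dense gcd≥D N N≢0 valCond =
  δ²αβD²≤1000XY X Y D δ 0≤X 0≤Y 0≤D (<⇒≤ 0<δ) (length A) (length B) ⟦ length Ω ⟧ (∑ ratio Ω) (∑ (ratio ∘ swap) Ω)
    Ω-dense (0≤⟦⟧ (length Ω)) (length²≤∑*∑ ratio (ratio ∘ swap) Ω (λ ω _ → ratio-reciprocal ω))
    (∑-nonNeg ratio Ω λ ω _ → 0≤ratio ω)
    (D*∑ratio≤ D (⟦ 2 ⟧ * Y) 0≤D (0≤* (0≤⟦⟧ 2) 0≤Y) A B Ω Ω-unique Ω⊆A×B (bounded 1≤Y B-range) D*c*c≤N)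
    (D*∑ratio∘swap≤ D (⟦ 2 ⟧ * X) 0≤D (0≤* (0≤⟦⟧ 2) 0≤X) A B Ω Ω-unique Ω⊆A×B (bounded 1≤X A-range) D*c*c≤N)
  where
  instance _ = N≢0
  open Reciprocals N (cofactor N) (λ b → cofactor-nonZero N b) (N∣*cofactor N)
  0≤X = ≤-trans (0≤⟦⟧ 1) 1≤X; 0≤Y = ≤-trans (0≤⟦⟧ 1) 1≤Y; 0≤D = ≤-trans (0≤⟦⟧ 1) 1≤D
  bounded : ∀ {Z Cs} → 1ℚ ≤ Z → (∀ x → x ∈ Cs → Z ≤ ⟦ x ⟧ × ⟦ x ⟧ ≤ ⟦ 2 ⟧ * Z) →
            ∀ x → x ∈ Cs → 0 ℕ.< x × ⟦ x ⟧ ≤ ⟦ 2 ⟧ * Z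
  bounded 1≤Z range x x∈Cs = ⟦⟧-cancel-≤ {1} (≤-trans 1≤Z (proj₁ (range x x∈Cs))) , proj₂ (range x x∈Cs)
  D*c*c≤N : ∀ a b → (a , b) ∈ Ω → D * ⟦ cofactor N a ⟧ * ⟦ cofactor N b ⟧ ≤ ⟦ N ⟧
  D*c*c≤N a b ab∈Ω =
    D*cofactor*cofactor≤N N a b {{N≢0}} {{ℕ.>-nonZero (proj₁ (bounded 1≤X A-range a a∈A))}}
      {{ℕ.>-nonZero (proj₁ (bounded 1≤Y B-range b b∈B))}} (λ p p-prime → valCond p p-prime a b ab∈Ω) (gcd≥D a b ab∈Ω)
    where
    a∈A = proj₁ (Ω⊆A×B a b ab∈Ω); b∈B = proj₂ (Ω⊆A×B a b ab∈Ω)
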